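{- Let $S$ be a Latin Square of any order $n$. Then $S$ either contains all three of the patterns $123$, $231$, $312$, or contains none of them. Likewise, $S$ either contains all three of the patterns $132$, $213$, $321$, or contains none of them.
   Context: An $n$-th order Latin Square is an $n\times n$ grid filled with the symbols $1,\dots,n$ such that each symbol appears exactly once in each row and each column. Rows read left to right and columns read top to bottom give permutations of $\{1,\dots,n\}$. A permutation contains a pattern $\pi\in S_k$ if some length-$k$ subsequence is order isomorphic to $\pi$. A Latin Square contains $\pi$ if at least one of its row or column permutations contains $\pi$, and avoids $\pi$ otherwise. -}

module Defs where

open import Data.Nat using (ℕ)
open import Data.Fin using (Fin; _<_)
open import Data.Product using (Σ; _×_)
open import Data.Sum using (_⊎_)
open import Data.Vec using (Vec; lookup; _∷_; [])
open import Data.Fin.Patterns using (0F; 1F; 2F)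
open import Function using (_∘_; _⇔_)
open import Function.Definitions using (Injective)
open import Relation.Binary.PropositionalEquality using (_≡_)
open import Relation.Nullary using (¬_)

-- Symbols 1..n are represented by Fin n
-- (symbol s ↔ index s-1), which is order preserving.
Word : ℕ → Set
Word n = Fin n → Fin n

record LatinSquare (n : ℕ) : Set where
  field
    entry    : Fin n → Fin n → Fin n
    rowInj   : ∀ i → Injective _≡_ _≡_ (entry i)
    colInj   : ∀ j → Injective _≡_ _≡_ (λ i → entry i j)

open LatinSquare public

-- Injective maps Fin n → Fin n are bijections, so injectivity of every row
-- and column is exactly "each symbol appears exactly once".

StrictlyIncreasing : ∀ {k n} → (Fin k → Fin n) → Set
StrictlyIncreasing {k} f = ∀ (a b : Fin k) → a < b → f a < f b

Contains : ∀ {k n} → (π : Fin k → Fin k) → (w : Fin n → Fin n) → Set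
Contains {k} {n} π w =
  Σ (Fin k → Fin n) λ f → StrictlyIncreasing f ×
    (∀ (a b : Fin k) → ((w (f a) < w (f b)) ⇔ (π a < π b)))

row : ∀ {n} → LatinSquare n → Fin n → Word n
row L i = λ j → entry L i j

col : ∀ {n} → LatinSquare n → Fin n → Word n
col L j = λ i → entry L i j

LSContains : ∀ {k n} → (Fin k → Fin k) → LatinSquare n → Set
LSContains {n = n} π L =
  Σ (Fin n) λ i → Contains π (row L i) ⊎ Contains π (col L i)

-- Patterns in S_3 in one-line notation, symbols written 0-based
-- (e.g. 231 ↦ [1,2,0]).
pat : Vec (Fin 3) 3 → (Fin 3 → Fin 3)
pat v = lookup v

p123 p231 p312 p132 p213 p321 : Fin 3 → Fin 3
p123 = pat (0F ∷ 1F ∷ 2F ∷ [])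
p231 = pat (1F ∷ 2F ∷ 0F ∷ [])
p312 = pat (2F ∷ 0F ∷ 1F ∷ [])
p132 = pat (0F ∷ 2F ∷ 1F ∷ [])
p213 = pat (1F ∷ 0F ∷ 2F ∷ [])
p321 = pat (2F ∷ 1F ∷ 0F ∷ [])

module Submission where

open import Defs
open import Data.Nat as ℕ using (ℕ; zero; suc; _+_; _∸_; z≤n; s≤s)
import Data.Nat.Properties as ℕP
open import Data.Fin as F using (Fin; zero; suc; toℕ; fromℕ; inject₁; opposite; _<_)
import Data.Fin.Properties as FP
open import Data.Fin.Patterns using (0F; 1F; 2F)
open import Data.Product using (∃; _×_; _,_; proj₁; proj₂; uncurry; map)
open import Data.Sum using (_⊎_; inj₁; inj₂; [_,_])
open import Relation.Nullary using (Dec; yes; no; ¬_; contradiction)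
open import Relation.Nullary.Decidable using (map′; _×-dec_; _→-dec_; _⊎-dec_)
open import Relation.Binary.Definitions using (tri<; tri≈; tri>)
open import Relation.Binary.PropositionalEquality
  using (_≡_; _≢_; refl; sym; trans; cong; cong₂; subst; subst₂; _≗_; module ≡-Reasoning)
open import Function using (id; _∘_; _⇔_; mk⇔; Equivalence)
import Function.Properties.Equivalence as ⇔
open import Function.Definitions using (Injective)

-- Corollary 7: a Latin square contains all or none of 123, 231, 312, and all
-- or none of 132, 213, 321.  As containment is decidable, it suffices to show
-- that avoiding one pattern of a class forces avoiding the whole class.
--
-- The heart is a structural theorem (rows-cyclicallyDecreasing): if every row
-- of a Latin square decreases strictly after its symbol 0, then every row is
-- cyclically decreasing, c, c-1, …, 0, n-1, …, c+1.  One shows that the 1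
-- stands just before the 0 in every row, and that this situation is inherited
-- by the square with all symbols lowered cyclically by one.  Cyclically
-- decreasing words avoid 123, 231 and 312.  Avoiding 123 yields the hypothesis
-- for all rows and (via the transpose) columns; avoiding 312 yields it after
-- raising all symbols cyclically; 231 reduces to 312 by the reverse
-- complement, and the second class reduces to the first by complementation.

-- An injective endomap of a finite set is onto: if it missed y, punching y
-- out of its values would inject Fin (suc n) into Fin n.
injective⇒surjective : ∀ {n} {f : Fin n → Fin n} → Injective _≡_ _≡_ f →
  ∀ y → ∃ λ x → f x ≡ y
injective⇒surjective {suc n} {f} f-inj y with FP.any? (λ x → f x FP.≟ y)
... | yes hit = hit
... | no miss = contradiction (FP.injective⇒≤ squeeze-injective) ℕP.1+n≰n
  where
  y≢f : ∀ x → y ≢ f x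
  y≢f x e = miss (x , sym e)
  squeeze-injective : Injective _≡_ _≡_ (λ x → F.punchOut (y≢f x))
  squeeze-injective e = f-inj (FP.punchOut-injective (y≢f _) (y≢f _) e)

strictlyIncreasing⇒injective : ∀ {k n} {f : Fin k → Fin n} → StrictlyIncreasing f →
  Injective _≡_ _≡_ f
strictlyIncreasing⇒injective inc {a} {b} e with FP.<-cmp a b
... | tri< a<b _ _ = contradiction e (FP.<⇒≢ (inc a b a<b))
... | tri≈ _ a≡b _ = a≡b
... | tri> _ _ b<a = contradiction (sym e) (FP.<⇒≢ (inc b a b<a))

contains⇒≤ : ∀ {k n} {π : Fin k → Fin k} {w : Fin n → Fin n} → Contains π w → k ℕ.≤ n
contains⇒≤ (_ , inc , _) = FP.injective⇒≤ (strictlyIncreasing⇒injective inc)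

maximal⇒last : ∀ {k} {o : Fin (suc k)} → (∀ s → ¬ o < s) → o ≡ fromℕ k
maximal⇒last {k} {o} maximal with o FP.≟ fromℕ k
... | yes o≡last = o≡last
... | no  o≢last = contradiction (FP.≤∧≢⇒< (FP.≤fromℕ o) o≢last) (maximal (fromℕ k))

nonzero⇒positive : ∀ {k} {x : Fin (suc k)} → x ≢ zero → F.zero {k} < x
nonzero⇒positive {x = zero}  x≢0 = contradiction refl x≢0
nonzero⇒positive {x = suc _} _   = ℕ.z<s

opposite-injective : ∀ {n} → Injective _≡_ _≡_ (opposite {n})
opposite-injective {x = x} {y} e =
  trans (sym (FP.opposite-involutive x)) (trans (cong opposite e) (FP.opposite-involutive y))

opposite-< : ∀ {n} {x y : Fin n} → x < y → opposite y < opposite x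
opposite-< {n} {x} {y} x<y = subst₂ ℕ._<_ (sym (FP.opposite-prop y)) (sym (FP.opposite-prop x))
  (ℕP.∸-monoʳ-< (s≤s x<y) (FP.toℕ<n y))

opposite-<-⇔ : ∀ {n} {x y : Fin n} → (opposite x < opposite y) ⇔ (y < x)
opposite-<-⇔ {x = x} {y} = mk⇔
  (subst₂ _<_ (FP.opposite-involutive y) (FP.opposite-involutive x) ∘ opposite-<)
  opposite-<

-- Cyclic predecessor and successor on Fin (suc k): x ↦ x - 1 and x ↦ x + 1
-- modulo k + 1.  They are mutually inverse, and away from the wrap-around
-- point they shift toℕ by one, so they preserve the order there.
cpred : ∀ {k} → Fin (suc k) → Fin (suc k)
cpred {k} zero = fromℕ k
cpred (suc i) = inject₁ i

csuc : ∀ {k} → Fin (suc k) → Fin (suc k)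
csuc {zero}  zero    = zero
csuc {suc k} zero    = suc zero
csuc {suc k} (suc i) with csuc {k} i
... | zero  = zero
... | suc j = suc (suc j)

cpred-csuc : ∀ {k} (x : Fin (suc k)) → cpred (csuc x) ≡ x
cpred-csuc {zero}  zero = refl
cpred-csuc {suc k} zero = refl
cpred-csuc {suc k} (suc i) with csuc {k} i | cpred-csuc {k} i
... | zero  | e = cong suc e
... | suc j | e = cong suc e

csuc-cpred : ∀ {k} (x : Fin (suc k)) → csuc (cpred x) ≡ x
csuc-cpred {k} zero = csuc-last k
  where
  csuc-last : ∀ k → csuc (fromℕ k) ≡ zero
  csuc-last zero = refl
  csuc-last (suc k) rewrite csuc-last k = refl
csuc-cpred (suc i) = csuc-inject₁ i
  where
  csuc-inject₁ : ∀ {k} (i : Fin k) → csuc (inject₁ i) ≡ suc i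
  csuc-inject₁ {suc k} zero = refl
  csuc-inject₁ {suc k} (suc i) rewrite csuc-inject₁ i = refl

cpred-injective : ∀ {k} → Injective _≡_ _≡_ (cpred {k})
cpred-injective {x = x} {y} e = trans (sym (csuc-cpred x)) (trans (cong csuc e) (csuc-cpred y))

csuc-injective : ∀ {k} → Injective _≡_ _≡_ (csuc {k})
csuc-injective {x = x} {y} e = trans (sym (cpred-csuc x)) (trans (cong cpred e) (cpred-csuc y))

toℕ-cpred : ∀ {k} {x : Fin (suc k)} → x ≢ zero → suc (toℕ (cpred x)) ≡ toℕ x
toℕ-cpred {x = zero}  x≢0 = contradiction refl x≢0
toℕ-cpred {x = suc i} _   = cong suc (FP.toℕ-inject₁ i)

cpred-< : ∀ {k} {x y : Fin (suc k)} → x ≢ zero → x < y → cpred x < cpred y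
cpred-< {x = x} {y} x≢0 x<y =
  ℕ.s≤s⁻¹ (subst₂ ℕ._<_ (sym (toℕ-cpred x≢0)) (sym (toℕ-cpred y≢0)) x<y)
  where
  y≢0 : y ≢ zero
  y≢0 refl = ℕP.n≮0 x<y

cpred-<-cpred-zero : ∀ {k} {x : Fin (suc k)} → x ≢ zero → cpred x < cpred zero
cpred-<-cpred-zero {k} {x} x≢0 = subst (toℕ (cpred x) ℕ.<_) (sym (FP.toℕ-fromℕ k))
  (subst (ℕ._≤ k) (sym (toℕ-cpred x≢0)) (ℕ.s≤s⁻¹ (FP.toℕ<n x)))

cpred≡zero : ∀ {m} {x : Fin (suc (suc m))} → cpred x ≡ zero → x ≡ suc zero
cpred≡zero {x = suc zero} _ = refl

csuc≡zero : ∀ {k} {x : Fin (suc k)} → csuc x ≡ zero → x ≡ fromℕ k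
csuc≡zero {x = x} e = trans (sym (cpred-csuc x)) (cong cpred e)

toℕ-csuc : ∀ {k} {x : Fin (suc k)} → x ≢ fromℕ k → toℕ (csuc x) ≡ suc (toℕ x)
toℕ-csuc {x = x} x≢last =
  trans (sym (toℕ-cpred (x≢last ∘ csuc≡zero))) (cong (suc ∘ toℕ) (cpred-csuc x))

csuc-< : ∀ {k} {x y : Fin (suc k)} → y ≢ fromℕ k → x < y → csuc x < csuc y
csuc-< {k} {x} {y} y≢last x<y =
  subst₂ ℕ._<_ (sym (toℕ-csuc x≢last)) (sym (toℕ-csuc y≢last)) (s≤s x<y)
  where
  x≢last : x ≢ fromℕ k
  x≢last refl = ℕP.<⇒≱ x<y
    (subst (toℕ y ℕ.≤_) (sym (FP.toℕ-fromℕ k)) (ℕ.s≤s⁻¹ (FP.toℕ<n y)))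

cpred^ : ∀ {k} → ℕ → Fin (suc k) → Fin (suc k)
cpred^ zero    x = x
cpred^ (suc t) x = cpred (cpred^ t x)

cpred^-injective : ∀ {k} t → Injective _≡_ _≡_ (cpred^ {k} t)
cpred^-injective zero    e = e
cpred^-injective (suc t) e = cpred^-injective t (cpred-injective e)

cpred^-cpred : ∀ {k} t (x : Fin (suc k)) → cpred^ t (cpred x) ≡ cpred (cpred^ t x)
cpred^-cpred zero    x = refl
cpred^-cpred (suc t) x = cong cpred (cpred^-cpred t x)

cpred^-toℕ : ∀ {k} (x : Fin (suc k)) → cpred^ (toℕ x) x ≡ zero
cpred^-toℕ x = go (toℕ x) x refl
  where
  go : ∀ {k} t (x : Fin (suc k)) → toℕ x ≡ t → cpred^ t x ≡ zero
  go zero    zero    _ = refl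
  go (suc t) (suc i) e = trans (sym (cpred^-cpred t (suc i)))
    (go t (inject₁ i) (trans (FP.toℕ-inject₁ i) (ℕP.suc-injective e)))

relabel : ∀ {n} (σ : Fin n → Fin n) → Injective _≡_ _≡_ σ → LatinSquare n → LatinSquare n
relabel σ σ-inj S = record
  { entry  = λ i j → σ (entry S i j)
  ; rowInj = λ i e → rowInj S i (σ-inj e)
  ; colInj = λ j e → colInj S j (σ-inj e)
  }

transpose : ∀ {n} → LatinSquare n → LatinSquare n
transpose S = record { entry = λ i j → entry S j i ; rowInj = colInj S ; colInj = rowInj S }

halfTurn : ∀ {n} → LatinSquare n → LatinSquare n
halfTurn S = record
  { entry  = λ i j → entry S (opposite i) (opposite j)
  ; rowInj = λ i e → opposite-injective (rowInj S (opposite i) e)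
  ; colInj = λ j e → opposite-injective (colInj S (opposite j) e)
  }

complement : ∀ {n} → LatinSquare n → LatinSquare n
complement = relabel opposite opposite-injective

reverseComplement : ∀ {n} → LatinSquare n → LatinSquare n
reverseComplement = complement ∘ halfTurn

SameEntries : ∀ {n} → LatinSquare n → LatinSquare n → Set
SameEntries S T = ∀ i j → entry S i j ≡ entry T i j

complement-involutive : ∀ {n} (S : LatinSquare n) → SameEntries (complement (complement S)) S
complement-involutive S i j = FP.opposite-involutive (entry S i j)

reverseComplement-involutive : ∀ {n} (S : LatinSquare n) →
  SameEntries (reverseComplement (reverseComplement S)) S
reverseComplement-involutive S i j = trans (FP.opposite-involutive _)
  (cong₂ (entry S) (FP.opposite-involutive i) (FP.opposite-involutive j))

OccursAt : ∀ {k n} → (Fin k → Fin k) → (Fin n → Fin n) → (Fin k → Fin n) → Set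
OccursAt π w f = StrictlyIncreasing f × (∀ a b → (w (f a) < w (f b)) ⇔ (π a < π b))

occursAt-cong : ∀ {k n} {π : Fin k → Fin k} {w : Fin n → Fin n} {f g : Fin k → Fin n} →
  f ≗ g → OccursAt π w f → OccursAt π w g
occursAt-cong {π = π} {w} f≗g (inc , iso) =
  (λ a b → subst₂ _<_ (f≗g a) (f≗g b) ∘ inc a b) ,
  (λ a b → subst₂ (λ u v → (w u < w v) ⇔ (π a < π b)) (f≗g a) (f≗g b) (iso a b))

contains-cong : ∀ {k n} {π π′ : Fin k → Fin k} {w w′ : Fin n → Fin n} →
  π ≗ π′ → w ≗ w′ → Contains π w → Contains π′ w′
contains-cong {π = π} {π′} {w} {w′} π≗π′ w≗w′ (f , inc , iso) = f , inc , λ a b →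
  subst₂ (λ u v → (u < v) ⇔ (π′ a < π′ b)) (w≗w′ (f a)) (w≗w′ (f b))
    (subst₂ (λ u v → (w (f a) < w (f b)) ⇔ (u < v)) (π≗π′ a) (π≗π′ b) (iso a b))

contains-complement : ∀ {k n} {π : Fin k → Fin k} {w : Fin n → Fin n} →
  Contains π w → Contains (opposite ∘ π) (opposite ∘ w)
contains-complement (f , inc , iso) = f , inc , λ a b →
  ⇔.trans opposite-<-⇔ (⇔.trans (iso b a) (⇔.sym opposite-<-⇔))

contains-reverse : ∀ {k n} {π : Fin k → Fin k} {w : Fin n → Fin n} →
  Contains π w → Contains (π ∘ opposite) (w ∘ opposite)
contains-reverse {π = π} {w} (f , inc , iso) = opposite ∘ f ∘ opposite ,
  (λ a b → opposite-< ∘ inc (opposite b) (opposite a) ∘ opposite-<) ,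
  (λ a b → subst₂ (λ u v → (w u < w v) ⇔ (π (opposite a) < π (opposite b)))
             (sym (FP.opposite-involutive _)) (sym (FP.opposite-involutive _))
             (iso (opposite a) (opposite b)))

LSContains-cong : ∀ {k n} {π π′ : Fin k → Fin k} (S T : LatinSquare n) →
  π ≗ π′ → SameEntries S T → LSContains π S → LSContains π′ T
LSContains-cong S T π≗π′ same (i , inj₁ c) =
  i , inj₁ (contains-cong {w = row S i} {row T i} π≗π′ (same i) c)
LSContains-cong S T π≗π′ same (j , inj₂ c) =
  j , inj₂ (contains-cong {w = col S j} {col T j} π≗π′ (λ i → same i j) c)

LSContains-complement : ∀ {k n} {π : Fin k → Fin k} (S : LatinSquare n) →
  LSContains π S → LSContains (opposite ∘ π) (complement S)
LSContains-complement S (i , inj₁ c) = i , inj₁ (contains-complement {w = row S i} c)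
LSContains-complement S (j , inj₂ c) = j , inj₂ (contains-complement {w = col S j} c)

LSContains-reverseComplement : ∀ {k n} {π : Fin k → Fin k} (S : LatinSquare n) →
  LSContains π S → LSContains (opposite ∘ π ∘ opposite) (reverseComplement S)
LSContains-reverseComplement {π = π} S (i , inj₁ c) = opposite i , inj₁
  (contains-complement {w = row S i′ ∘ opposite} (contains-reverse {w = row S i′} c′))
  where
  i′ : Fin _
  i′ = opposite (opposite i)
  c′ : Contains π (row S i′)
  c′ = subst (Contains π ∘ row S) (sym (FP.opposite-involutive i)) c
LSContains-reverseComplement {π = π} S (j , inj₂ c) = opposite j , inj₂
  (contains-complement {w = col S j′ ∘ opposite} (contains-reverse {w = col S j′} c′))
  where
  j′ : Fin _
  j′ = opposite (opposite j)
  c′ : Contains π (col S j′)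
  c′ = subst (Contains π ∘ col S) (sym (FP.opposite-involutive j)) c

-- Since both operations are involutions, a square contains π iff its
-- transform contains the transformed pattern.
complement-⇔ : ∀ {k n} {π π′ : Fin k → Fin k} (S : LatinSquare n) →
  opposite ∘ π ≗ π′ → LSContains π S ⇔ LSContains π′ (complement S)
complement-⇔ {π = π} {π′} S e = mk⇔
  (LSContains-cong (complement S) (complement S) e (λ _ _ → refl) ∘ LSContains-complement S)
  (LSContains-cong (complement (complement S)) S undo (complement-involutive S)
     ∘ LSContains-complement (complement S))
  where
  undo : opposite ∘ π′ ≗ π
  undo x = trans (cong opposite (sym (e x))) (FP.opposite-involutive (π x))

reverseComplement-⇔ : ∀ {k n} {π π′ : Fin k → Fin k} (S : LatinSquare n) →
  opposite ∘ π ∘ opposite ≗ π′ → LSContains π S ⇔ LSContains π′ (reverseComplement S)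
reverseComplement-⇔ {π = π} {π′} S e = mk⇔
  (LSContains-cong (reverseComplement S) (reverseComplement S) e (λ _ _ → refl)
     ∘ LSContains-reverseComplement S)
  (LSContains-cong (reverseComplement (reverseComplement S)) S undo
     (reverseComplement-involutive S) ∘ LSContains-reverseComplement (reverseComplement S))
  where
  undo : opposite ∘ π′ ∘ opposite ≗ π
  undo x = trans (cong opposite (sym (e (opposite x))))
    (trans (FP.opposite-involutive _) (cong π (FP.opposite-involutive x)))

rc-123 : opposite ∘ p123 ∘ opposite ≗ p123
rc-123 = λ { 0F → refl ; 1F → refl ; 2F → refl }

rc-231 : opposite ∘ p231 ∘ opposite ≗ p312
rc-231 = λ { 0F → refl ; 1F → refl ; 2F → refl }

rc-312 : opposite ∘ p312 ∘ opposite ≗ p231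
rc-312 = λ { 0F → refl ; 1F → refl ; 2F → refl }

complement-132 : opposite ∘ p132 ≗ p312
complement-132 = λ { 0F → refl ; 1F → refl ; 2F → refl }

complement-213 : opposite ∘ p213 ≗ p231
complement-213 = λ { 0F → refl ; 1F → refl ; 2F → refl }

complement-321 : opposite ∘ p321 ≗ p123
complement-321 = λ { 0F → refl ; 1F → refl ; 2F → refl }

0<1 : _<_ {3} {3} 0F 1F
0<1 = s≤s z≤n

1<2 : _<_ {3} {3} 1F 2F
1<2 = s≤s (s≤s z≤n)

triple : ∀ {n} → Fin n → Fin n → Fin n → Fin 3 → Fin n
triple p q s 0F = p
triple p q s 1F = q
triple p q s 2F = s

triple-increasing : ∀ {n} {p q s : Fin n} → p < q → q < s → StrictlyIncreasing (triple p q s)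
triple-increasing p<q q<s 0F 1F _ = p<q
triple-increasing p<q q<s 0F 2F _ = ℕP.<-trans p<q q<s
triple-increasing p<q q<s 1F 2F _ = q<s
triple-increasing p<q q<s 0F 0F ()
triple-increasing p<q q<s 1F 0F ()
triple-increasing p<q q<s 1F 1F (s≤s ())
triple-increasing p<q q<s 2F 0F ()
triple-increasing p<q q<s 2F 1F (s≤s ())
triple-increasing p<q q<s 2F 2F (s≤s (s≤s ()))

triple-η : ∀ {n} (f : Fin 3 → Fin n) → f ≗ triple (f 0F) (f 1F) (f 2F)
triple-η f 0F = refl
triple-η f 1F = refl
triple-η f 2F = refl

-- To exhibit an occurrence of π at increasing positions f it suffices to
-- give increasing values g with w ∘ f = g ∘ π: the order of values is then
-- forced to be that of π.
occurrence : ∀ {k n} {π : Fin k → Fin k} {w : Fin n → Fin n} (f : Fin k → Fin n)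
  {g : Fin k → Fin n} → StrictlyIncreasing f → StrictlyIncreasing g →
  (∀ a → w (f a) ≡ g (π a)) → Contains π w
occurrence {π = π} {w} f {g} f-inc g-inc shape =
  f , f-inc , λ a b → mk⇔ (reflects a b) (preserves a b)
  where
  preserves : ∀ a b → π a < π b → w (f a) < w (f b)
  preserves a b lt = subst₂ _<_ (sym (shape a)) (sym (shape b)) (g-inc (π a) (π b) lt)
  reflects : ∀ a b → w (f a) < w (f b) → π a < π b
  reflects a b lt with FP.<-cmp (π a) (π b)
  ... | tri< πa<πb _ _ = πa<πb
  ... | tri≈ _ πa≡πb _ = contradiction (trans (shape a) (trans (cong g πa≡πb) (sym (shape b))))
                                       (FP.<⇒≢ lt)
  ... | tri> _ _ πb<πa = contradiction lt (FP.<-asym (preserves b a πb<πa))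

-- Containment of a length-3 pattern is decidable by exhaustive search over
-- the position triples; this is what lets us conclude "all or none".
_⇔?_ : ∀ {A B : Set} → Dec A → Dec B → Dec (A ⇔ B)
a? ⇔? b? = map′ (uncurry mk⇔) (λ e → Equivalence.to e , Equivalence.from e)
  ((a? →-dec b?) ×-dec (b? →-dec a?))

occursAt? : ∀ {k n} (π : Fin k → Fin k) (w : Fin n → Fin n) (f : Fin k → Fin n) →
  Dec (OccursAt π w f)
occursAt? π w f =
  FP.all? (λ a → FP.all? (λ b → (a FP.<? b) →-dec (f a FP.<? f b))) ×-dec
  FP.all? (λ a → FP.all? (λ b → (w (f a) FP.<? w (f b)) ⇔? (π a FP.<? π b)))

contains? : ∀ {n} (π : Fin 3 → Fin 3) (w : Fin n → Fin n) → Dec (Contains π w)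
contains? π w = map′
  (λ (p , q , s , occ) → triple p q s , occ)
  (λ (f , occ) → f 0F , f 1F , f 2F , occursAt-cong {w = w} (triple-η f) occ)
  (FP.any? λ p → FP.any? λ q → FP.any? λ s → occursAt? π w (triple p q s))

LSContains? : ∀ {n} (π : Fin 3 → Fin 3) (S : LatinSquare n) → Dec (LSContains π S)
LSContains? π S = FP.any? λ i → contains? π (row S i) ⊎-dec contains? π (col S i)

-- w steps down by one, cyclically, from each position to the next; for a
-- permutation this means w = c, c-1, …, 0, k, k-1, …, c+1.
CyclicallyDecreasing : ∀ {k} → (Fin (suc k) → Fin (suc k)) → Set
CyclicallyDecreasing w = ∀ a b → toℕ b ≡ suc (toℕ a) → w b ≡ cpred (w a)

-- A cyclically decreasing permutation w, with its symbol 0 at position z,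
-- contains none of 123, 231, 312: it strictly decreases on both sides of z,
-- and everything up to z lies below everything after z.
module CyclicallyDecreasingWord {k} {w : Fin (suc k) → Fin (suc k)}
  (w-inj : Injective _≡_ _≡_ w) (cd : CyclicallyDecreasing w)
  (z : Fin (suc k)) (wz≡0 : w z ≡ zero) where

  ZeroOutside : Fin (suc k) → Fin (suc k) → Set
  ZeroOutside a b = ¬ (toℕ a ℕ.≤ toℕ z × toℕ z ℕ.< toℕ b)

  drop-by-distance : ∀ d a b → toℕ b ≡ d + toℕ a → ZeroOutside a b →
    toℕ (w a) ≡ d + toℕ (w b)
  drop-by-distance zero    a b b≡a _   = cong (toℕ ∘ w) (FP.toℕ-injective (sym b≡a))
  drop-by-distance (suc d) a b b≡1+d+a out = begin
    toℕ (w a)               ≡⟨ toℕ-cpred wa≢0 ⟨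
    suc (toℕ (cpred (w a))) ≡⟨ cong (suc ∘ toℕ) (cd a a′ toℕ-a′) ⟨
    suc (toℕ (w a′))        ≡⟨ cong suc (drop-by-distance d a′ b b≡d+a′ out′) ⟩
    suc (d + toℕ (w b))     ∎
    where
    open ≡-Reasoning
    a<b : toℕ a ℕ.< toℕ b
    a<b = subst (toℕ a ℕ.<_) (sym b≡1+d+a) (ℕP.m<n+m (toℕ a) ℕ.z<s)
    1+a<1+k : suc (toℕ a) ℕ.< suc k
    1+a<1+k = ℕP.<-≤-trans (s≤s a<b) (FP.toℕ<n b)
    a′ : Fin (suc k)
    a′ = F.fromℕ< 1+a<1+k
    toℕ-a′ : toℕ a′ ≡ suc (toℕ a)
    toℕ-a′ = FP.toℕ-fromℕ< 1+a<1+k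
    wa≢0 : w a ≢ zero
    wa≢0 e with w-inj (trans e (sym wz≡0))
    ... | refl = out (ℕP.≤-refl , a<b)
    out′ : ZeroOutside a′ b
    out′ (a′≤z , z<b) =
      out (ℕP.≤-trans (ℕP.n≤1+n (toℕ a)) (subst (ℕ._≤ toℕ z) toℕ-a′ a′≤z) , z<b)
    b≡d+a′ : toℕ b ≡ d + toℕ a′
    b≡d+a′ = trans b≡1+d+a (trans (sym (ℕP.+-suc d (toℕ a))) (cong (d +_) (sym toℕ-a′)))

  descent : ∀ {a b} → a < b → ZeroOutside a b → w b < w a
  descent {a} {b} a<b out =
    subst (toℕ (w b) ℕ.<_) (sym wa≡d+wb) (ℕP.m<n+m (toℕ (w b)) (ℕP.m<n⇒0<n∸m a<b))
    where
    wa≡d+wb : toℕ (w a) ≡ (toℕ b ∸ toℕ a) + toℕ (w b)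
    wa≡d+wb = drop-by-distance _ a b (sym (ℕP.m∸n+n≡m (ℕP.<⇒≤ a<b))) out

  ascent-straddles-zero : ∀ {a b} → a < b → w a < w b →
    toℕ a ℕ.≤ toℕ z × toℕ z ℕ.< toℕ b
  ascent-straddles-zero {a} {b} a<b wa<wb with (toℕ a ℕP.≤? toℕ z) ×-dec (toℕ z ℕP.<? toℕ b)
  ... | yes straddle = straddle
  ... | no  out      = contradiction (descent a<b out) (ℕP.<-asym wa<wb)

  -- Up to the zero the values are at most z (they count down to 0) ...
  values-up-to-zero : ∀ {a} → toℕ a ℕ.≤ toℕ z → toℕ (w a) ℕ.≤ toℕ z
  values-up-to-zero {a} a≤z = subst (ℕ._≤ toℕ z) (sym wa≡z∸a) (ℕP.m∸n≤m (toℕ z) (toℕ a))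
    where
    wa≡z∸a : toℕ (w a) ≡ toℕ z ∸ toℕ a
    wa≡z∸a = trans
      (drop-by-distance _ a z (sym (ℕP.m∸n+n≡m a≤z)) (λ (_ , z<z) → ℕP.<-irrefl refl z<z))
      (trans (cong (λ v → toℕ z ∸ toℕ a + toℕ v) wz≡0) (ℕP.+-identityʳ _))

  -- ... while after it they exceed z: they count down from k, reaching
  -- position c ≤ k after c - (z + 1) steps.
  values-after-zero : ∀ {c} → toℕ z ℕ.< toℕ c → toℕ z ℕ.< toℕ (w c)
  values-after-zero {c} z<c = ℕP.+-cancelˡ-≤ d _ _ (subst₂ ℕ._≤_
      (trans (sym (ℕP.m∸n+n≡m z′≤c)) (cong (d +_) toℕ-z′)) k≡d+wc
      (ℕ.s≤s⁻¹ (FP.toℕ<n c)))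
    where
    1+z<1+k : suc (toℕ z) ℕ.< suc k
    1+z<1+k = ℕP.<-≤-trans (s≤s z<c) (FP.toℕ<n c)
    z′ : Fin (suc k)
    z′ = F.fromℕ< 1+z<1+k
    toℕ-z′ : toℕ z′ ≡ suc (toℕ z)
    toℕ-z′ = FP.toℕ-fromℕ< 1+z<1+k
    wz′≡k : toℕ (w z′) ≡ k
    wz′≡k = trans (cong toℕ (trans (cd z z′ toℕ-z′) (cong cpred wz≡0))) (FP.toℕ-fromℕ k)
    d : ℕ
    d = toℕ c ∸ toℕ z′
    z′≤c : toℕ z′ ℕ.≤ toℕ c
    z′≤c = subst (ℕ._≤ toℕ c) (sym toℕ-z′) z<c
    k≡d+wc : k ≡ d + toℕ (w c)
    k≡d+wc = trans (sym wz′≡k) (drop-by-distance d z′ c (sym (ℕP.m∸n+n≡m z′≤c))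
      (λ (z′≤z , _) → ℕP.<-irrefl refl (subst (ℕ._≤ toℕ z) toℕ-z′ z′≤z)))

  ascent-across-zero : ∀ {a c} → toℕ a ℕ.≤ toℕ z → toℕ z ℕ.< toℕ c → w a < w c
  ascent-across-zero a≤z z<c = ℕP.≤-<-trans (values-up-to-zero a≤z) (values-after-zero z<c)

  -- Two consecutive ascents would both have to straddle the zero.
  avoids-123 : ¬ Contains p123 w
  avoids-123 (f , inc , iso) =
    let (_ , z<f1) = ascent-straddles-zero (inc 0F 1F 0<1) (Equivalence.from (iso 0F 1F) 0<1)
        (f1≤z , _) = ascent-straddles-zero (inc 1F 2F 1<2) (Equivalence.from (iso 1F 2F) 1<2)
    in ℕP.<-irrefl refl (ℕP.<-≤-trans z<f1 f1≤z)

  -- The ascent 2-3 straddles the zero, so the outer pair 2-1 straddles it too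
  -- and must be an ascent.
  avoids-231 : ¬ Contains p231 w
  avoids-231 (f , inc , iso) =
    let (f0≤z , z<f1) = ascent-straddles-zero (inc 0F 1F 0<1) (Equivalence.from (iso 0F 1F) 1<2)
    in ℕP.<-asym (Equivalence.from (iso 2F 0F) 0<1)
         (ascent-across-zero f0≤z (ℕP.<-trans z<f1 (inc 1F 2F 1<2)))

  -- Symmetrically, the ascent 1-2 forces the outer pair 3-2 to be an ascent.
  avoids-312 : ¬ Contains p312 w
  avoids-312 (f , inc , iso) =
    let (f1≤z , z<f2) = ascent-straddles-zero (inc 1F 2F 1<2) (Equivalence.from (iso 1F 2F) 0<1)
    in ℕP.<-asym (Equivalence.from (iso 2F 0F) 1<2)
         (ascent-across-zero (ℕP.≤-trans (ℕP.<⇒≤ (inc 0F 1F 0<1)) f1≤z) z<f2)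

DecreasingAfterZero : ∀ {k} → (Fin (suc k) → Fin (suc k)) → Set
DecreasingAfterZero w = ∀ p q s → w p ≡ zero → p < q → q < s → w s < w q

OneBeforeZero : ∀ {m} → (Fin (suc (suc m)) → Fin (suc (suc m))) → Set
OneBeforeZero w =
  ∀ p z → w p ≡ suc zero → w z ≡ zero → toℕ z ≢ 0 → toℕ z ≡ suc (toℕ p)

-- In an injective word decreasing after its 0, a 1 placed after the 0 must
-- be the last entry: anything after it would be a second 0.
nothing-after-one : ∀ {m} {w : Fin (suc (suc m)) → Fin (suc (suc m))} →
  Injective _≡_ _≡_ w → DecreasingAfterZero w →
  ∀ {z o} → w z ≡ zero → w o ≡ suc zero → z < o → ∀ s → ¬ o < s
nothing-after-one {w = w} w-inj daz {z} {o} wz≡0 wo≡1 z<o s o<s =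
  FP.<-irrefl (w-inj (trans wz≡0 (sym ws≡0))) (ℕP.<-trans z<o o<s)
  where
  ws≡0 : w s ≡ zero
  ws≡0 = FP.toℕ-injective (ℕP.n<1⇒n≡0
    (subst ((toℕ (w s) ℕ.<_) ∘ toℕ) wo≡1 (daz z o s wz≡0 z<o o<s)))

-- If every row of a Latin square (of order at least 2) decreases after its 0,
-- then in every row the 1 stands just before the 0.  The row r₀ with its 0 in
-- the first column has its 1 in the last column; by uniqueness in that column
-- every other row has its 1 before its 0, and an induction on the column of
-- the 0 shows the gap is exactly one.
module RowsOneBeforeZero {m} (S : LatinSquare (suc (suc m)))
  (daz : ∀ i → DecreasingAfterZero (row S i)) where

  private
    N : ℕ
    N = suc (suc m)

    one : Fin N
    one = suc zero

    last : Fin N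
    last = fromℕ (suc m)

    rowWith : Fin N → Fin N → Fin N
    rowWith j v = proj₁ (injective⇒surjective (colInj S j) v)

    rowWith-entry : ∀ j v → entry S (rowWith j v) j ≡ v
    rowWith-entry j v = proj₂ (injective⇒surjective (colInj S j) v)

    colWith : Fin N → Fin N → Fin N
    colWith i v = proj₁ (injective⇒surjective (rowInj S i) v)

    colWith-entry : ∀ i v → entry S i (colWith i v) ≡ v
    colWith-entry i v = proj₂ (injective⇒surjective (rowInj S i) v)

    r₀ : Fin N
    r₀ = rowWith zero zero

    first-row : entry S r₀ last ≡ one
    first-row = subst (λ o → entry S r₀ o ≡ one) o≡last (colWith-entry r₀ one)
      where
      o≢0 : colWith r₀ one ≢ zero
      o≢0 o≡0 with trans (sym (colWith-entry r₀ one))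
                         (trans (cong (entry S r₀) o≡0) (rowWith-entry zero zero))
      ... | ()
      o≡last : colWith r₀ one ≡ last
      o≡last = maximal⇒last (nothing-after-one (rowInj S r₀) (daz r₀)
        (rowWith-entry zero zero) (colWith-entry r₀ one) (nonzero⇒positive o≢0))

    -- In a row whose 0 is not in the first column, the 1 comes before the 0:
    -- otherwise that 1 would be in the last column, i.e. the row is r₀.
    one-before-zero : ∀ r {z o} → entry S r z ≡ zero → entry S r o ≡ one → toℕ z ≢ 0 →
      o < z
    one-before-zero r {z} {o} rz≡0 ro≡1 z≢0 with FP.<-cmp o z
    ... | tri< o<z _ _ = o<z
    ... | tri≈ _ refl _ with trans (sym ro≡1) rz≡0
    ...   | ()
    one-before-zero r {z} {o} rz≡0 ro≡1 z≢0 | tri> _ _ z<o = contradiction (cong toℕ z≡0) z≢0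
      where
      o≡last : o ≡ last
      o≡last = maximal⇒last (nothing-after-one (rowInj S r) (daz r) rz≡0 ro≡1 z<o)
      r≡r₀ : r ≡ r₀
      r≡r₀ = colInj S last
        (trans (subst (λ c → entry S r c ≡ one) o≡last ro≡1) (sym first-row))
      z≡0 : z ≡ zero
      z≡0 = rowInj S r (trans rz≡0
        (sym (subst (λ x → entry S x zero ≡ zero) (sym r≡r₀) (rowWith-entry zero zero))))

    -- Suppose the 1 of row r is at o and its 0 at z > o + 1.  The row r′ with
    -- its 0 in column c = o + 1 has, by induction (c < z), its 1 in column o;
    -- uniqueness in column o gives r′ = r, and then uniqueness in row r gives
    -- c = z, a contradiction.
    one-just-before-zero : ∀ bound r {z o} → toℕ z ℕ.< bound →
      entry S r z ≡ zero → entry S r o ≡ one → toℕ z ≢ 0 → toℕ z ≡ suc (toℕ o)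
    one-just-before-zero (suc bound) r {z} {o} z<1+bound rz≡0 ro≡1 z≢0
      with suc (toℕ o) ℕP.≟ toℕ z
    ... | yes adjacent = sym adjacent
    ... | no  gap      = contradiction (cong toℕ c≡z) (ℕP.<⇒≢ c<z)
      where
      1+o<z : suc (toℕ o) ℕ.< toℕ z
      1+o<z = ℕP.≤∧≢⇒< (one-before-zero r rz≡0 ro≡1 z≢0) gap
      1+o<N : suc (toℕ o) ℕ.< N
      1+o<N = ℕP.<-trans 1+o<z (FP.toℕ<n z)
      c : Fin N
      c = F.fromℕ< 1+o<N
      toℕ-c : toℕ c ≡ suc (toℕ o)
      toℕ-c = FP.toℕ-fromℕ< 1+o<N
      c<z : toℕ c ℕ.< toℕ z
      c<z = subst (ℕ._< toℕ z) (sym toℕ-c) 1+o<z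
      r′ o′ : Fin N
      r′ = rowWith c zero
      o′ = colWith r′ one
      c≡1+o′ : toℕ c ≡ suc (toℕ o′)
      c≡1+o′ = one-just-before-zero bound r′ (ℕP.<-≤-trans c<z (ℕ.s≤s⁻¹ z<1+bound))
        (rowWith-entry c zero) (colWith-entry r′ one)
        (λ c≡0 → ℕP.1+n≢0 (trans (sym toℕ-c) c≡0))
      o′≡o : o′ ≡ o
      o′≡o = FP.toℕ-injective (ℕP.suc-injective (trans (sym c≡1+o′) toℕ-c))
      r′≡r : r′ ≡ r
      r′≡r = colInj S o
        (trans (subst (λ x → entry S r′ x ≡ one) o′≡o (colWith-entry r′ one)) (sym ro≡1))
      c≡z : c ≡ z
      c≡z = rowInj S r
        (trans (subst (λ x → entry S x c ≡ zero) r′≡r (rowWith-entry c zero)) (sym rz≡0))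

  oneBeforeZero : ∀ r → OneBeforeZero (row S r)
  oneBeforeZero r o z ro≡1 rz≡0 z≢0 = one-just-before-zero N r (FP.toℕ<n z) rz≡0 ro≡1 z≢0

-- Lowering every symbol cyclically by one keeps a word decreasing after its
-- new 0 (the old 1), as the old 0 follows it and becomes the largest symbol.
cpred-preserves : ∀ {m} {w : Fin (suc (suc m)) → Fin (suc (suc m))} → Injective _≡_ _≡_ w →
  DecreasingAfterZero w → OneBeforeZero w → DecreasingAfterZero (cpred ∘ w)
cpred-preserves {w = w} w-inj daz obz p q s wp↦0 p<q q<s =
  [ zero-before-q , zero-at-q ] (ℕP.m≤n⇒m<n∨m≡n z≤q)
  where
  z : Fin _
  z = proj₁ (injective⇒surjective w-inj zero)
  wz≡0 : w z ≡ zero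
  wz≡0 = proj₂ (injective⇒surjective w-inj zero)
  z≤q : toℕ z ℕ.≤ toℕ q
  z≤q with toℕ z ℕP.≟ 0
  ... | yes z≡0 = subst (ℕ._≤ toℕ q) (sym z≡0) z≤n
  ... | no  z≢0 = subst (ℕ._≤ toℕ q) (sym (obz p z (cpred≡zero wp↦0) wz≡0 z≢0)) p<q
  nonzero-after : ∀ {x} → z < x → w x ≢ zero
  nonzero-after z<x wx≡0 = FP.<⇒≢ z<x (w-inj (trans wz≡0 (sym wx≡0)))
  zero-before-q : z < q → cpred (w s) < cpred (w q)
  zero-before-q z<q = cpred-< (nonzero-after (ℕP.<-trans z<q q<s)) (daz z q s wz≡0 z<q q<s)
  zero-at-q : toℕ z ≡ toℕ q → cpred (w s) < cpred (w q)
  zero-at-q z≡q = subst (λ v → cpred (w s) < cpred v) (sym wq≡0)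
    (cpred-<-cpred-zero (nonzero-after (subst (ℕ._< toℕ s) (sym z≡q) q<s)))
    where
    wq≡0 : w q ≡ zero
    wq≡0 = trans (cong w (FP.toℕ-injective (sym z≡q))) wz≡0

-- If the 1 stands just before the 0 in every cyclic relabelling of w, then w
-- is cyclically decreasing: for consecutive positions a, b relabel so that
-- w b becomes 0; then w a must have become 1.
cyclicallyDecreasing-from-shifts : ∀ {m} {w : Fin (suc (suc m)) → Fin (suc (suc m))} →
  Injective _≡_ _≡_ w → (∀ t → OneBeforeZero (cpred^ t ∘ w)) → CyclicallyDecreasing w
cyclicallyDecreasing-from-shifts {w = w} w-inj obz a b b≡1+a = cpred^-injective t (begin
  cpred^ t (w b)         ≡⟨ cpred^-toℕ (w b) ⟩
  zero                   ≡⟨ cong cpred wa↦1 ⟨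
  cpred (cpred^ t (w a)) ≡⟨ cpred^-cpred t (w a) ⟨
  cpred^ t (cpred (w a)) ∎)
  where
  open ≡-Reasoning
  t : ℕ
  t = toℕ (w b)
  shifted-inj : Injective _≡_ _≡_ (cpred^ t ∘ w)
  shifted-inj = w-inj ∘ cpred^-injective t
  p : Fin _
  p = proj₁ (injective⇒surjective shifted-inj (suc zero))
  wp↦1 : cpred^ t (w p) ≡ suc zero
  wp↦1 = proj₂ (injective⇒surjective shifted-inj (suc zero))
  p≡a : p ≡ a
  p≡a = FP.toℕ-injective (ℕP.suc-injective (trans
    (sym (obz t p b wp↦1 (cpred^-toℕ (w b)) (λ b≡0 → ℕP.1+n≢0 (trans (sym b≡1+a) b≡0))))
    b≡1+a))
  wa↦1 : cpred^ t (w a) ≡ suc zero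
  wa↦1 = subst (λ x → cpred^ t (w x) ≡ suc zero) p≡a wp↦1

shift : ∀ {k} → ℕ → LatinSquare (suc k) → LatinSquare (suc k)
shift t = relabel (cpred^ t) (cpred^-injective t)

-- Lowering all symbols preserves
-- the hypothesis (cpred-preserves with RowsOneBeforeZero), so the 1 stands
-- before the 0 in every shifted square.
rows-cyclicallyDecreasing : ∀ {m} (S : LatinSquare (suc (suc m))) →
  (∀ i → DecreasingAfterZero (row S i)) → ∀ i → CyclicallyDecreasing (row S i)
rows-cyclicallyDecreasing S daz i =
  cyclicallyDecreasing-from-shifts (rowInj S i) (λ t → oneBeforeZero (shift t S) (daz-shifted t) i)
  where
  open RowsOneBeforeZero using (oneBeforeZero)
  daz-shifted : ∀ t i → DecreasingAfterZero (row (shift t S) i)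
  daz-shifted zero    = daz
  daz-shifted (suc t) i = cpred-preserves (rowInj (shift t S) i) (daz-shifted t i)
    (oneBeforeZero (shift t S) (daz-shifted t) i)

injective-compare : ∀ {n} {w : Fin n → Fin n} → Injective _≡_ _≡_ w →
  ∀ {q s} → q < s → w s < w q ⊎ w q < w s
injective-compare {w = w} w-inj {q} {s} q<s with FP.<-cmp (w s) (w q)
... | tri< ws<wq _ _ = inj₁ ws<wq
... | tri≈ _ ws≡wq _ = contradiction (sym (w-inj ws≡wq)) (FP.<⇒≢ q<s)
... | tri> _ _ wq<ws = inj₂ wq<ws

-- A 123-avoiding word decreases after its 0: an ascent q < s after the 0 at p
-- would complete an occurrence p, q, s of 123.
avoids-123⇒decreasingAfterZero : ∀ {k} {w : Fin (suc k) → Fin (suc k)} →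
  Injective _≡_ _≡_ w → ¬ Contains p123 w → DecreasingAfterZero w
avoids-123⇒decreasingAfterZero {w = w} w-inj avoid p q s wp≡0 p<q q<s =
  [ id , (λ wq<ws → contradiction (occurrence-123 wq<ws) avoid) ]
    (injective-compare w-inj q<s)
  where
  wp<wq : w p < w q
  wp<wq = subst (_< w q) (sym wp≡0)
    (nonzero⇒positive (λ wq≡0 → FP.<⇒≢ p<q (w-inj (trans wp≡0 (sym wq≡0)))))
  occurrence-123 : w q < w s → Contains p123 w
  occurrence-123 wq<ws = occurrence (triple p q s) (triple-increasing p<q q<s)
    (triple-increasing wp<wq wq<ws) λ { 0F → refl ; 1F → refl ; 2F → refl }

-- A 312-avoiding word decreases after its largest symbol, i.e. after the 0
-- of its cyclic successor csuc ∘ w: an ascent q < s after the maximum at p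
-- would complete an occurrence p, q, s of 312.
avoids-312⇒decreasingAfterZero : ∀ {k} {w : Fin (suc k) → Fin (suc k)} →
  Injective _≡_ _≡_ w → ¬ Contains p312 w → DecreasingAfterZero (csuc ∘ w)
avoids-312⇒decreasingAfterZero {k} {w} w-inj avoid p q s wp↦0 p<q q<s =
  [ csuc-< (not-max p<q) , (λ wq<ws → contradiction (occurrence-312 wq<ws) avoid) ]
    (injective-compare w-inj q<s)
  where
  wp≡max : w p ≡ fromℕ k
  wp≡max = csuc≡zero wp↦0
  not-max : ∀ {x} → p < x → w x ≢ fromℕ k
  not-max p<x wx≡max = FP.<⇒≢ p<x (w-inj (trans wp≡max (sym wx≡max)))
  ws<wp : w s < w p
  ws<wp = subst (w s <_) (sym wp≡max)
    (FP.≤∧≢⇒< (FP.≤fromℕ (w s)) (not-max (ℕP.<-trans p<q q<s)))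
  occurrence-312 : w q < w s → Contains p312 w
  occurrence-312 wq<ws = occurrence (triple p q s) (triple-increasing p<q q<s)
    (triple-increasing wq<ws ws<wp) λ { 0F → refl ; 1F → refl ; 2F → refl }

cyclicallyDecreasing-csuc⁻ : ∀ {k} {w : Fin (suc k) → Fin (suc k)} →
  CyclicallyDecreasing (csuc ∘ w) → CyclicallyDecreasing w
cyclicallyDecreasing-csuc⁻ {w = w} cd a b b≡1+a =
  trans (sym (cpred-csuc (w b))) (cong cpred (trans (cd a b b≡1+a) (cpred-csuc (w a))))

row-avoids : ∀ {k n} {π : Fin k → Fin k} (S : LatinSquare n) →
  ¬ LSContains π S → ∀ i → ¬ Contains π (row S i)
row-avoids S avoid i c = avoid (i , inj₁ c)

col-avoids : ∀ {k n} {π : Fin k → Fin k} (S : LatinSquare n) →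
  ¬ LSContains π S → ∀ j → ¬ Contains π (col S j)
col-avoids S avoid j c = avoid (j , inj₂ c)

lines-avoid : ∀ {k n} {π : Fin k → Fin k} (S : LatinSquare n) →
  (∀ i → ¬ Contains π (row S i)) → (∀ j → ¬ Contains π (col S j)) → ¬ LSContains π S
lines-avoid S rows cols (i , inj₁ c) = rows i c
lines-avoid S rows cols (j , inj₂ c) = cols j c

AvoidsAll : ∀ {n} → (π₁ π₂ π₃ : Fin 3 → Fin 3) → LatinSquare n → Set
AvoidsAll π₁ π₂ π₃ S = ¬ LSContains π₁ S × ¬ LSContains π₂ S × ¬ LSContains π₃ S

AvoidsOne : ∀ {n} → (π₁ π₂ π₃ : Fin 3 → Fin 3) → LatinSquare n → Set
AvoidsOne π₁ π₂ π₃ S = ¬ LSContains π₁ S ⊎ ¬ LSContains π₂ S ⊎ ¬ LSContains π₃ S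

small-avoids : ∀ {n} (S : LatinSquare n) {π : Fin 3 → Fin 3} → n ℕ.< 3 → ¬ LSContains π S
small-avoids S n<3 (i , inj₁ c) = ℕP.<⇒≱ n<3 (contains⇒≤ {w = row S i} c)
small-avoids S n<3 (j , inj₂ c) = ℕP.<⇒≱ n<3 (contains⇒≤ {w = col S j} c)

small-avoidsAll : ∀ {n} (S : LatinSquare n) {π₁ π₂ π₃ : Fin 3 → Fin 3} → n ℕ.< 3 →
  AvoidsAll π₁ π₂ π₃ S
small-avoidsAll S n<3 = small-avoids S n<3 , small-avoids S n<3 , small-avoids S n<3

lines-cyclicallyDecreasing : ∀ {m} (S : LatinSquare (suc (suc m))) →
  (∀ i → DecreasingAfterZero (row S i)) → (∀ j → DecreasingAfterZero (col S j)) →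
  (∀ i → CyclicallyDecreasing (row S i)) × (∀ j → CyclicallyDecreasing (col S j))
lines-cyclicallyDecreasing S rows cols =
  rows-cyclicallyDecreasing S rows , rows-cyclicallyDecreasing (transpose S) cols

cyclicallyDecreasing⇒avoids : ∀ {k} {w : Fin (suc k) → Fin (suc k)} → Injective _≡_ _≡_ w →
  CyclicallyDecreasing w → ¬ Contains p123 w × ¬ Contains p231 w × ¬ Contains p312 w
cyclicallyDecreasing⇒avoids {w = w} w-inj cd = avoids-123 , avoids-231 , avoids-312
  where
  zero-position : ∃ λ z → w z ≡ zero
  zero-position = injective⇒surjective w-inj zero
  open CyclicallyDecreasingWord w-inj cd (proj₁ zero-position) (proj₂ zero-position)

cyclicallyDecreasing-avoids : ∀ {k} (S : LatinSquare (suc k)) →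
  (∀ i → CyclicallyDecreasing (row S i)) × (∀ j → CyclicallyDecreasing (col S j)) →
  AvoidsAll p123 p231 p312 S
cyclicallyDecreasing-avoids S (rows , cols) =
  lines-avoid S (proj₁ ∘ inRow) (proj₁ ∘ inCol) ,
  lines-avoid S (proj₁ ∘ proj₂ ∘ inRow) (proj₁ ∘ proj₂ ∘ inCol) ,
  lines-avoid S (proj₂ ∘ proj₂ ∘ inRow) (proj₂ ∘ proj₂ ∘ inCol)
  where
  inRow : ∀ i → ¬ Contains p123 (row S i) × ¬ Contains p231 (row S i) × ¬ Contains p312 (row S i)
  inRow i = cyclicallyDecreasing⇒avoids (rowInj S i) (rows i)
  inCol : ∀ j → ¬ Contains p123 (col S j) × ¬ Contains p231 (col S j) × ¬ Contains p312 (col S j)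
  inCol j = cyclicallyDecreasing⇒avoids (colInj S j) (cols j)

avoids-123⇒avoidsAll : ∀ {m} (S : LatinSquare (suc (suc m))) →
  ¬ LSContains p123 S → AvoidsAll p123 p231 p312 S
avoids-123⇒avoidsAll S avoid = cyclicallyDecreasing-avoids S (lines-cyclicallyDecreasing S
  (λ i → avoids-123⇒decreasingAfterZero (rowInj S i) (row-avoids S avoid i))
  (λ j → avoids-123⇒decreasingAfterZero (colInj S j) (col-avoids S avoid j)))

avoids-312⇒avoidsAll : ∀ {m} (S : LatinSquare (suc (suc m))) →
  ¬ LSContains p312 S → AvoidsAll p123 p231 p312 S
avoids-312⇒avoidsAll S avoid = cyclicallyDecreasing-avoids S
  (map (cyclicallyDecreasing-csuc⁻ ∘_) (cyclicallyDecreasing-csuc⁻ ∘_)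
    (lines-cyclicallyDecreasing shifted
    (λ i → avoids-312⇒decreasingAfterZero (rowInj S i) (row-avoids S avoid i))
    (λ j → avoids-312⇒decreasingAfterZero (colInj S j) (col-avoids S avoid j))))
  where
  shifted : LatinSquare _
  shifted = relabel csuc csuc-injective S

-- 231 reduces to 312 through the reverse complement, which fixes 123 and
-- swaps 231 with 312.
avoids-231⇒avoidsAll : ∀ {m} (S : LatinSquare (suc (suc m))) →
  ¬ LSContains p231 S → AvoidsAll p123 p231 p312 S
avoids-231⇒avoidsAll S avoid =
  let (no123 , no231 , _) = rc-avoidsAll
  in no123 ∘ to (reverseComplement-⇔ S rc-123) , avoid , no231 ∘ to (reverseComplement-⇔ S rc-312)
  where
  open Equivalence
  rc-avoidsAll : AvoidsAll p123 p231 p312 (reverseComplement S)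
  rc-avoidsAll = avoids-312⇒avoidsAll (reverseComplement S)
    (avoid ∘ from (reverseComplement-⇔ S rc-231))

avoidsOne⇒avoidsAll₁ : ∀ {n} (S : LatinSquare n) →
  AvoidsOne p123 p231 p312 S → AvoidsAll p123 p231 p312 S
avoidsOne⇒avoidsAll₁ {zero}        S _ = small-avoidsAll S ℕP.0<1+n
avoidsOne⇒avoidsAll₁ {suc zero}    S _ = small-avoidsAll S (s≤s ℕP.0<1+n)
avoidsOne⇒avoidsAll₁ {suc (suc m)} S =
  [ avoids-123⇒avoidsAll S , [ avoids-231⇒avoidsAll S , avoids-312⇒avoidsAll S ] ]

-- The second class 132, 213, 321 is the complement of the first.
avoidsOne⇒avoidsAll₂ : ∀ {n} (S : LatinSquare n) →
  AvoidsOne p132 p213 p321 S → AvoidsAll p132 p213 p321 S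
avoidsOne⇒avoidsAll₂ S avoidsOne =
  let (no123 , no231 , no312) = avoidsOne⇒avoidsAll₁ (complement S) complementAvoidsOne
  in no312 ∘ to 132⇔312 , no231 ∘ to 213⇔231 , no123 ∘ to 321⇔123
  where
  open Equivalence
  132⇔312 : LSContains p132 S ⇔ LSContains p312 (complement S)
  132⇔312 = complement-⇔ S complement-132
  213⇔231 : LSContains p213 S ⇔ LSContains p231 (complement S)
  213⇔231 = complement-⇔ S complement-213
  321⇔123 : LSContains p321 S ⇔ LSContains p123 (complement S)
  321⇔123 = complement-⇔ S complement-321
  complementAvoidsOne : AvoidsOne p123 p231 p312 (complement S)
  complementAvoidsOne =
    [ (λ no132 → inj₂ (inj₂ (no132 ∘ from 132⇔312))) ,
    [ (λ no213 → inj₂ (inj₁ (no213 ∘ from 213⇔231))) ,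
      (λ no321 → inj₁ (no321 ∘ from 321⇔123)) ] ] avoidsOne

all-or-none : ∀ {A B C : Set} → Dec A → Dec B → Dec C →
  (¬ A ⊎ ¬ B ⊎ ¬ C → ¬ A × ¬ B × ¬ C) → (A × B × C) ⊎ (¬ A × ¬ B × ¬ C)
all-or-none (yes a) (yes b) (yes c) _    = inj₁ (a , b , c)
all-or-none (no ¬a) _       _       none = inj₂ (none (inj₁ ¬a))
all-or-none (yes _) (no ¬b) _       none = inj₂ (none (inj₂ (inj₁ ¬b)))
all-or-none (yes _) (yes _) (no ¬c) none = inj₂ (none (inj₂ (inj₂ ¬c)))

corollary7 : ∀ (n : ℕ) (S : LatinSquare n) →
    ((LSContains p123 S × LSContains p231 S × LSContains p312 S)
      ⊎ (¬ LSContains p123 S × ¬ LSContains p231 S × ¬ LSContains p312 S))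
    × ((LSContains p132 S × LSContains p213 S × LSContains p321 S)
      ⊎ (¬ LSContains p132 S × ¬ LSContains p213 S × ¬ LSContains p321 S))
corollary7 n S =
  all-or-none (LSContains? p123 S) (LSContains? p231 S) (LSContains? p312 S) (avoidsOne⇒avoidsAll₁ S) ,
  all-or-none (LSContains? p132 S) (LSContains? p213 S) (LSContains? p321 S) (avoidsOne⇒avoidsAll₂ S)
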